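{- For all integers $1\le k\le n$ and every $\pi\in\Pi(n)$, \[ |S_{\mathrm{out}}(\pi;k)\cap S_{\mathrm{in}}(\pi;k)| = (n-k+1)\binom{k}{2} + \binom{k}{3} + 1. \]
   Context: $\Pi(n)$ denotes the set of permutations of $\{1,\dots,n\}$, each regarded as a sequence $\pi=(\pi_1,\dots,\pi_n)$. A TDRL operation on a sequence $(x_1,\dots,x_m)$ of distinct symbols is specified by a binary pattern $b\in\{0,1\}^m$. Its result is the concatenation of the subsequence $(x_i:b_i=1)$ with the subsequence $(x_i:b_i=0)$, each taken with indices in increasing order. A bounded TDRL operation of width $k$ on $\pi\in\Pi(n)$ proceeds as follows: choose $j$ with $1\le j\le n-k+1$, apply a TDRL operation to the segment $(\pi_j,\dots,\pi_{j+k-1})$, and replace this segment by the result, leaving all other entries in place. $S_{\mathrm{out}}(\pi;k)$ is the set of all permutations obtainable from $\pi$ by one bounded TDRL operation of width $k$. $S_{\mathrm{in}}(\pi;k)=\{\rho\in\Pi(n): \pi\in S_{\mathrm{out}}(\rho;k)\}$. -}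

module Defs where

open import Data.Nat using (ℕ; zero; suc; _+_; _≤_)
open import Data.Bool using (Bool; true; false)
open import Data.List using (List; []; _∷_; _++_; take; drop; length; map; upTo)
open import Data.List.Relation.Binary.Permutation.Propositional using (_↭_)
open import Data.Product using (Σ; _×_; ∃; ∃-syntax)
open import Relation.Binary.PropositionalEquality using (_≡_)

IsPerm : ℕ → List ℕ → Set
IsPerm n ρ = ρ ↭ map suc (upTo n)

ones : {A : Set} → List A → List Bool → List A
ones [] _ = []
ones (x ∷ xs) [] = []
ones (x ∷ xs) (true ∷ bs) = x ∷ ones xs bs
ones (x ∷ xs) (false ∷ bs) = ones xs bs

zeros : {A : Set} → List A → List Bool → List A
zeros [] _ = []
zeros (x ∷ xs) [] = []
zeros (x ∷ xs) (true ∷ bs) = zeros xs bs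
zeros (x ∷ xs) (false ∷ bs) = x ∷ zeros xs bs

-- TDRL operation with pattern b (used only with length b ≡ length xs)
tdrl : {A : Set} → List A → List Bool → List A
tdrl xs bs = ones xs bs ++ zeros xs bs

-- bounded TDRL of width k at 0-based start position i (i = j - 1)
boundedTdrl : ℕ → ℕ → List Bool → List ℕ → List ℕ
boundedTdrl k i b π = take i π ++ tdrl (take k (drop i π)) b ++ drop (i + k) π

InSout : ℕ → ℕ → List ℕ → List ℕ → Set
InSout n k π ρ = IsPerm n ρ ×
  (∃[ i ] ∃[ b ] ((i + k ≤ n) × (length b ≡ k) × (ρ ≡ boundedTdrl k i b π)))

InSin : ℕ → ℕ → List ℕ → List ℕ → Set
InSin n k π ρ = IsPerm n ρ × InSout n k ρ π

module Submission where

-- Relabelling π by its own entries reduces everything to the identity ι n = (0,…,n-1):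
-- bounded TDRLs commute with relabelling, so ρ ∈ S_out(π;k) ∩ S_in(π;k) exactly when
-- ρ = π ∘ w for a list w that one bounded TDRL of width k produces from ι n and another
-- one turns back into ι n.  The heart of the proof classifies these w:
--   * necessity: writing both steps as unbounded TDRLs, w is the concatenation of two
--     increasing runs which a TDRL sorts; this forces w to be ι n with two adjacent blocks
--     [p, p+a) and [p+a, p+a+c) exchanged, and since a bounded TDRL fixes every position
--     outside its window, a proper exchange (a, c ≥ 1) satisfies a + c ≤ k;
--   * sufficiency: every such exchange, and ι n itself, is reached and undone inside a
--     suitable window.
-- Finally the admissible triples (p, a, c) are enumerated span by span; there are
-- (n - k + 1)·C(k,2) + C(k,3) of them, and ι n contributes the remaining 1.

open import Defs
open import Data.Bool using (Bool; true; false)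
open import Data.Empty using (⊥-elim)
open import Data.List using (List; []; _∷_; _++_; take; drop; length; map; replicate; upTo)
open import Data.List.Properties
  using (∷-injective; ++-assoc; ++-identityʳ; length-++; length-map; length-replicate; length-take;
         length-upTo; map-++; take-map; drop-map; drop-drop; take++drop≡id)
open import Data.List.Membership.Propositional using (_∈_)
open import Data.List.Membership.Propositional.Properties
  using (∈-map⁺; ∈-map⁻; ∈-++⁺ˡ; ∈-++⁺ʳ; ∈-++⁻; ∈-upTo⁺; ∈-upTo⁻)
open import Data.List.Relation.Binary.Permutation.Propositional
  using (_↭_; prep; ↭-refl; ↭-sym; ↭-trans; ↭⇒↭ₛ; module PermutationReasoning)
import Data.List.Relation.Binary.Permutation.Propositional.Properties as Perm
import Data.List.Relation.Binary.Permutation.Setoid.Properties as PermSetoidProperties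
open import Data.List.Relation.Unary.All as All using (All; []; _∷_)
import Data.List.Relation.Unary.All.Properties as All
open import Data.List.Relation.Unary.AllPairs using (AllPairs; []; _∷_)
open import Data.List.Relation.Unary.Any using (here; there)
open import Data.List.Relation.Unary.Unique.Propositional using (Unique)
import Data.List.Relation.Unary.Unique.Propositional.Properties as Unique
open import Data.Nat using (ℕ; zero; suc; _+_; _*_; _∸_; _≤_; _<_; z≤n; s≤s; s<s)
open import Data.Nat.Combinatorics using (_C_; nC1≡n; nCk+nC[k+1]≡[n+1]C[k+1])
open import Data.Nat.Properties
open import Data.Nat.Tactic.RingSolver using (solve-∀)
open import Data.Product using (_×_; _,_; ∃-syntax; proj₁; proj₂)
open import Data.Sum using (_⊎_; inj₁; inj₂)
open import Function.Bundles using (_⇔_; mk⇔; module Equivalence)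
open import Function.Construct.Composition using (_⇔-∘_)
open import Function.Construct.Symmetry using (⇔-sym)
open import Relation.Binary.PropositionalEquality
open import Relation.Nullary using (¬_; yes; no)

private
  module PermSetoid = PermSetoidProperties (setoid ℕ)
  variable
    A B : Set

ones-++-aligned : (xs ys : List A) (cs ds : List Bool) → length cs ≡ length xs →
  ones (xs ++ ys) (cs ++ ds) ≡ ones xs cs ++ ones ys ds
ones-++-aligned []       ys []           ds eq = refl
ones-++-aligned (x ∷ xs) ys (true ∷ cs)  ds eq = cong (x ∷_) (ones-++-aligned xs ys cs ds (suc-injective eq))
ones-++-aligned (x ∷ xs) ys (false ∷ cs) ds eq = ones-++-aligned xs ys cs ds (suc-injective eq)

zeros-++-aligned : (xs ys : List A) (cs ds : List Bool) → length cs ≡ length xs →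
  zeros (xs ++ ys) (cs ++ ds) ≡ zeros xs cs ++ zeros ys ds
zeros-++-aligned []       ys []           ds eq = refl
zeros-++-aligned (x ∷ xs) ys (true ∷ cs)  ds eq = zeros-++-aligned xs ys cs ds (suc-injective eq)
zeros-++-aligned (x ∷ xs) ys (false ∷ cs) ds eq = cong (x ∷_) (zeros-++-aligned xs ys cs ds (suc-injective eq))

ones-all-true : (xs : List A) → ones xs (replicate (length xs) true) ≡ xs
ones-all-true []       = refl
ones-all-true (x ∷ xs) = cong (x ∷_) (ones-all-true xs)

zeros-all-true : (xs : List A) → zeros xs (replicate (length xs) true) ≡ []
zeros-all-true []       = refl
zeros-all-true (x ∷ xs) = zeros-all-true xs

ones-all-false : (xs : List A) → ones xs (replicate (length xs) false) ≡ []
ones-all-false []       = refl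
ones-all-false (x ∷ xs) = ones-all-false xs

zeros-all-false : (xs : List A) → zeros xs (replicate (length xs) false) ≡ xs
zeros-all-false []       = refl
zeros-all-false (x ∷ xs) = cong (x ∷_) (zeros-all-false xs)

-- Selection, and hence a TDRL, only looks at positions, so it commutes with relabelling.
ones-map : (f : A → B) (xs : List A) (cs : List Bool) → ones (map f xs) cs ≡ map f (ones xs cs)
ones-map f []       cs           = refl
ones-map f (x ∷ xs) []           = refl
ones-map f (x ∷ xs) (true ∷ cs)  = cong (f x ∷_) (ones-map f xs cs)
ones-map f (x ∷ xs) (false ∷ cs) = ones-map f xs cs

zeros-map : (f : A → B) (xs : List A) (cs : List Bool) → zeros (map f xs) cs ≡ map f (zeros xs cs)
zeros-map f []       cs           = refl
zeros-map f (x ∷ xs) []           = refl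
zeros-map f (x ∷ xs) (true ∷ cs)  = zeros-map f xs cs
zeros-map f (x ∷ xs) (false ∷ cs) = cong (f x ∷_) (zeros-map f xs cs)

tdrl-map : (f : A → B) (xs : List A) (cs : List Bool) → tdrl (map f xs) cs ≡ map f (tdrl xs cs)
tdrl-map f xs cs = begin
  ones (map f xs) cs ++ zeros (map f xs) cs   ≡⟨ cong₂ _++_ (ones-map f xs cs) (zeros-map f xs cs) ⟩
  map f (ones xs cs) ++ map f (zeros xs cs)   ≡⟨ map-++ f (ones xs cs) (zeros xs cs) ⟨
  map f (tdrl xs cs)                           ∎
  where open ≡-Reasoning

module _ {P : A → Set} where

  ones-All : (xs : List A) (cs : List Bool) → All P xs → All P (ones xs cs)
  ones-All []       cs           _          = []
  ones-All (x ∷ xs) []           _          = []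
  ones-All (x ∷ xs) (true ∷ cs)  (px ∷ pxs) = px ∷ ones-All xs cs pxs
  ones-All (x ∷ xs) (false ∷ cs) (px ∷ pxs) = ones-All xs cs pxs

  zeros-All : (xs : List A) (cs : List Bool) → All P xs → All P (zeros xs cs)
  zeros-All []       cs           _          = []
  zeros-All (x ∷ xs) []           _          = []
  zeros-All (x ∷ xs) (true ∷ cs)  (px ∷ pxs) = zeros-All xs cs pxs
  zeros-All (x ∷ xs) (false ∷ cs) (px ∷ pxs) = px ∷ zeros-All xs cs pxs

module _ {R : A → A → Set} where

  ones-AllPairs : (xs : List A) (cs : List Bool) → AllPairs R xs → AllPairs R (ones xs cs)
  ones-AllPairs []       cs           _        = []
  ones-AllPairs (x ∷ xs) []           _        = []
  ones-AllPairs (x ∷ xs) (true ∷ cs)  (r ∷ rs) = ones-All xs cs r ∷ ones-AllPairs xs cs rs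
  ones-AllPairs (x ∷ xs) (false ∷ cs) (r ∷ rs) = ones-AllPairs xs cs rs

  zeros-AllPairs : (xs : List A) (cs : List Bool) → AllPairs R xs → AllPairs R (zeros xs cs)
  zeros-AllPairs []       cs           _        = []
  zeros-AllPairs (x ∷ xs) []           _        = []
  zeros-AllPairs (x ∷ xs) (true ∷ cs)  (r ∷ rs) = zeros-AllPairs xs cs rs
  zeros-AllPairs (x ∷ xs) (false ∷ cs) (r ∷ rs) = zeros-All xs cs r ∷ zeros-AllPairs xs cs rs

tdrl-↭ : (xs : List A) (cs : List Bool) → length xs ≤ length cs → tdrl xs cs ↭ xs
tdrl-↭ []       cs           _        = ↭-refl
tdrl-↭ (x ∷ xs) (true ∷ cs)  (s≤s le) = prep x (tdrl-↭ xs cs le)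
tdrl-↭ (x ∷ xs) (false ∷ cs) (s≤s le) =
  ↭-trans (Perm.shift x (ones xs cs) (zeros xs cs)) (prep x (tdrl-↭ xs cs le))

tdrl-++-aligned : (X Y : List A) (cs ds : List Bool) → length cs ≡ length X →
  tdrl (X ++ Y) (cs ++ ds) ≡ (ones X cs ++ ones Y ds) ++ (zeros X cs ++ zeros Y ds)
tdrl-++-aligned X Y cs ds eq = cong₂ _++_ (ones-++-aligned X Y cs ds eq) (zeros-++-aligned X Y cs ds eq)

tdrl-inside : (X W S : List A) (b : List Bool) → length b ≡ length W →
  tdrl (X ++ W ++ S) (replicate (length X) true ++ b ++ replicate (length S) false) ≡ X ++ tdrl W b ++ S
tdrl-inside X W S b eq = begin
  ones (X ++ W ++ S) cs ++ zeros (X ++ W ++ S) cs  ≡⟨ cong₂ _++_ ones-part zeros-part ⟩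
  (X ++ ones W b) ++ zeros W b ++ S                ≡⟨ ++-assoc X (ones W b) _ ⟩
  X ++ ones W b ++ zeros W b ++ S                  ≡⟨ cong (X ++_) (++-assoc (ones W b) _ S) ⟨
  X ++ tdrl W b ++ S                               ∎
  where
  open ≡-Reasoning
  keep move cs : List Bool
  keep = replicate (length X) true
  move = replicate (length S) false
  cs = keep ++ b ++ move
  ones-part : ones (X ++ W ++ S) cs ≡ X ++ ones W b
  ones-part = begin
    ones (X ++ W ++ S) cs                     ≡⟨ ones-++-aligned X (W ++ S) keep (b ++ move) (length-replicate _) ⟩
    ones X keep ++ ones (W ++ S) (b ++ move)  ≡⟨ cong₂ _++_ (ones-all-true X) (ones-++-aligned W S b move eq) ⟩
    X ++ ones W b ++ ones S move              ≡⟨ cong (λ t → X ++ ones W b ++ t) (ones-all-false S) ⟩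
    X ++ ones W b ++ []                       ≡⟨ cong (X ++_) (++-identityʳ (ones W b)) ⟩
    X ++ ones W b                             ∎
  zeros-part : zeros (X ++ W ++ S) cs ≡ zeros W b ++ S
  zeros-part = begin
    zeros (X ++ W ++ S) cs                      ≡⟨ zeros-++-aligned X (W ++ S) keep (b ++ move) (length-replicate _) ⟩
    zeros X keep ++ zeros (W ++ S) (b ++ move)  ≡⟨ cong₂ _++_ (zeros-all-true X) (zeros-++-aligned W S b move eq) ⟩
    zeros W b ++ zeros S move                   ≡⟨ cong (zeros W b ++_) (zeros-all-false S) ⟩
    zeros W b ++ S                              ∎

tdrl-exchange : (X Y : List A) → tdrl (X ++ Y) (replicate (length X) false ++ replicate (length Y) true) ≡ Y ++ X
tdrl-exchange X Y = cong₂ _++_ ones-part zeros-part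
  where
  ones-part : ones (X ++ Y) (replicate (length X) false ++ replicate (length Y) true) ≡ Y
  ones-part = trans (ones-++-aligned X Y _ _ (length-replicate _))
                    (cong₂ _++_ (ones-all-false X) (ones-all-true Y))
  zeros-part : zeros (X ++ Y) (replicate (length X) false ++ replicate (length Y) true) ≡ X
  zeros-part = trans (zeros-++-aligned X Y _ _ (length-replicate _))
                     (trans (cong₂ _++_ (zeros-all-false X) (zeros-all-true Y)) (++-identityʳ X))

take-length-++ : (xs ys : List A) → take (length xs) (xs ++ ys) ≡ xs
take-length-++ []       ys = refl
take-length-++ (x ∷ xs) ys = cong (x ∷_) (take-length-++ xs ys)

drop-length-++ : (xs ys : List A) → drop (length xs) (xs ++ ys) ≡ ys
drop-length-++ []       ys = refl
drop-length-++ (x ∷ xs) ys = drop-length-++ xs ys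

drop-length+-++ : (xs ys : List A) (m : ℕ) → drop (length xs + m) (xs ++ ys) ≡ drop m ys
drop-length+-++ []       ys m = refl
drop-length+-++ (x ∷ xs) ys m = drop-length+-++ xs ys m

split-at : (m : ℕ) (xs : List A) → m ≤ length xs → ∃[ X ] ∃[ Y ] ((xs ≡ X ++ Y) × (length X ≡ m))
split-at zero    xs       _        = [] , xs , refl , refl
split-at (suc m) (x ∷ xs) (s≤s le) with split-at m xs le
... | X , Y , refl , refl = x ∷ X , Y , refl , refl

window-split : (i k : ℕ) (xs : List A) → i + k ≤ length xs →
  ∃[ X ] ∃[ W ] ∃[ S ] ((xs ≡ X ++ W ++ S) × (length X ≡ i) × (length W ≡ k))
window-split zero    zero    xs       _        = [] , [] , xs , refl , refl , refl
window-split zero    (suc k) (x ∷ xs) (s≤s le) with window-split zero k xs le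
... | [] , W , S , refl , _ , refl = [] , x ∷ W , S , refl , refl , refl
window-split (suc i) k       (x ∷ xs) (s≤s le) with window-split i k xs le
... | X , W , S , refl , refl , refl = x ∷ X , W , S , refl , refl , refl

boundedTdrl-window : (X W S : List ℕ) (b : List Bool) →
  boundedTdrl (length W) (length X) b (X ++ W ++ S) ≡ X ++ tdrl W b ++ S
boundedTdrl-window X W S b
  rewrite take-length-++ X (W ++ S) | drop-length-++ X (W ++ S) | take-length-++ W S
        | drop-length+-++ X (W ++ S) (length W) | drop-length-++ W S = refl

boundedTdrl-map : (f : ℕ → ℕ) (k i : ℕ) (b : List Bool) (xs : List ℕ) →
  boundedTdrl k i b (map f xs) ≡ map f (boundedTdrl k i b xs)
boundedTdrl-map f k i b xs = begin
  take i (map f xs) ++ tdrl (take k (drop i (map f xs))) b ++ drop (i + k) (map f xs)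
    ≡⟨ cong₂ (λ u v → u ++ tdrl v b ++ drop (i + k) (map f xs))
             (take-map i xs) (trans (cong (take k) (drop-map i xs)) (take-map k (drop i xs))) ⟩
  map f (take i xs) ++ tdrl (map f W) b ++ drop (i + k) (map f xs)
    ≡⟨ cong₂ (λ u v → map f (take i xs) ++ u ++ v) (tdrl-map f W b) (drop-map (i + k) xs) ⟩
  map f (take i xs) ++ map f (tdrl W b) ++ map f (drop (i + k) xs)
    ≡⟨ cong (map f (take i xs) ++_) (map-++ f (tdrl W b) _) ⟨
  map f (take i xs) ++ map f (tdrl W b ++ drop (i + k) xs)
    ≡⟨ map-++ f (take i xs) _ ⟨
  map f (boundedTdrl k i b xs) ∎
  where
  open ≡-Reasoning
  W : List ℕ
  W = take k (drop i xs)

boundedTdrl-↭ : (k i : ℕ) (b : List Bool) (xs : List ℕ) → length b ≡ k → boundedTdrl k i b xs ↭ xs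
boundedTdrl-↭ k i b xs |b| = begin
  take i xs ++ tdrl W b ++ drop (i + k) xs  ↭⟨ Perm.++⁺ˡ (take i xs) (Perm.++⁺ʳ _ (tdrl-↭ W b W≤b)) ⟩
  take i xs ++ W ++ drop (i + k) xs         ≡⟨ cong (take i xs ++_) W++rest ⟩
  take i xs ++ drop i xs                    ≡⟨ take++drop≡id i xs ⟩
  xs                                        ∎
  where
  open PermutationReasoning
  W : List ℕ
  W = take k (drop i xs)
  W≤b : length W ≤ length b
  W≤b = ≤-trans (≤-reflexive (length-take k (drop i xs))) (≤-trans (m⊓n≤m k _) (≤-reflexive (sym |b|)))
  W++rest : W ++ drop (i + k) xs ≡ drop i xs
  W++rest = trans (cong (W ++_) (sym (drop-drop i k xs))) (take++drop≡id k (drop i xs))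

length-boundedTdrl : (k i : ℕ) (b : List Bool) (xs : List ℕ) → length b ≡ k →
  length (boundedTdrl k i b xs) ≡ length xs
length-boundedTdrl k i b xs |b| = Perm.↭-length (boundedTdrl-↭ k i b xs |b|)

-- A bounded TDRL is in particular a TDRL of the whole list: the pattern selects
-- everything before the window and nothing after it.
boundedTdrl-is-tdrl : (k i : ℕ) (b : List Bool) (xs : List ℕ) → i + k ≤ length xs → length b ≡ k →
  ∃[ cs ] ((length cs ≡ length xs) × (boundedTdrl k i b xs ≡ tdrl xs cs))
boundedTdrl-is-tdrl k i b xs fits |b| with window-split i k xs fits
... | X , W , S , refl , refl , refl =
  replicate (length X) true ++ b ++ replicate (length S) false ,
  length-pattern ,
  trans (boundedTdrl-window X W S b) (sym (tdrl-inside X W S b |b|))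
  where
  length-pattern : length (replicate (length X) true ++ b ++ replicate (length S) false) ≡ length (X ++ W ++ S)
  length-pattern rewrite length-++ (replicate (length X) true) {b ++ replicate (length S) false}
                       | length-++ b {replicate (length S) false}
                       | length-replicate (length X) {true} | length-replicate (length S) {false}
                       | length-++ X {W ++ S} | length-++ W {S} | |b| = refl

boundedTdrl-all-true : (k : ℕ) (xs : List ℕ) → k ≤ length xs → boundedTdrl k 0 (replicate k true) xs ≡ xs
boundedTdrl-all-true k xs fits with window-split 0 k xs fits
... | [] , W , S , refl , _ , refl = begin
  boundedTdrl (length W) 0 (replicate (length W) true) (W ++ S)  ≡⟨ boundedTdrl-window [] W S _ ⟩
  (ones W (replicate (length W) true) ++ zeros W (replicate (length W) true)) ++ S
    ≡⟨ cong₂ (λ O Z → (O ++ Z) ++ S) (ones-all-true W) (zeros-all-true W) ⟩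
  (W ++ []) ++ S                                                  ≡⟨ cong (_++ S) (++-identityʳ W) ⟩
  W ++ S                                                          ∎
  where open ≡-Reasoning

interval : ℕ → ℕ → List ℕ
interval s zero    = []
interval s (suc l) = s ∷ interval (suc s) l

ι : ℕ → List ℕ
ι n = interval 0 n

length-interval : (s l : ℕ) → length (interval s l) ≡ l
length-interval s zero    = refl
length-interval s (suc l) = cong suc (length-interval (suc s) l)

interval-++ : (s l m : ℕ) → interval s (l + m) ≡ interval s l ++ interval (s + l) m
interval-++ s zero    m = cong (λ t → interval t m) (sym (+-identityʳ s))
interval-++ s (suc l) m = cong (s ∷_) (trans (interval-++ (suc s) l m) (cong (λ t → interval (suc s) l ++ interval t m) (sym (+-suc s l))))

interval-lower : (s l : ℕ) → All (s ≤_) (interval s l)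
interval-lower s zero    = []
interval-lower s (suc l) = ≤-refl ∷ All.map (≤-trans (n≤1+n s)) (interval-lower (suc s) l)

interval-upper : (s l : ℕ) → All (_< s + l) (interval s l)
interval-upper s zero    = []
interval-upper s (suc l) rewrite +-suc s l = s<s (m≤m+n s l) ∷ interval-upper (suc s) l

interval-increasing : (s l : ℕ) → AllPairs _<_ (interval s l)
interval-increasing s zero    = []
interval-increasing s (suc l) = interval-lower (suc s) l ∷ interval-increasing (suc s) l

interval-split : (s n : ℕ) (U V : List ℕ) → interval s n ≡ U ++ V →
  ∃[ l ] ∃[ m ] ((l + m ≡ n) × (U ≡ interval s l) × (V ≡ interval (s + l) m))
interval-split s n       []      V eq = 0 , n , refl , refl , trans (sym eq) (cong (λ t → interval t n) (sym (+-identityʳ s)))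
interval-split s (suc n) (u ∷ U) V eq with ∷-injective eq
... | refl , eq′ with interval-split (suc s) n U V eq′
... | l , m , refl , refl , refl = suc l , m , refl , refl , cong (λ t → interval t m) (sym (+-suc s l))

interval-parts-bounds : (s n : ℕ) (U V : List ℕ) → interval s n ≡ U ++ V →
  All (_< s + length U) U × All (s + length U ≤_) V
interval-parts-bounds s n U V eq with interval-split s n U V eq
... | l , m , refl , refl , refl rewrite length-interval s l = interval-upper s l , interval-lower (s + l) m

-- entry xs d is the entry of xs at position d (0 beyond the end).
entry : List ℕ → ℕ → ℕ
entry []       _       = 0
entry (x ∷ xs) zero    = x
entry (x ∷ xs) (suc d) = entry xs d

entry-++ˡ : (X Y : List ℕ) {d : ℕ} → d < length X → entry (X ++ Y) d ≡ entry X d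
entry-++ˡ (x ∷ X) Y {zero}  _         = refl
entry-++ˡ (x ∷ X) Y {suc d} (s≤s lt) = entry-++ˡ X Y lt

entry-++ʳ : (X Y : List ℕ) (e : ℕ) → entry (X ++ Y) (length X + e) ≡ entry Y e
entry-++ʳ []      Y e = refl
entry-++ʳ (x ∷ X) Y e = entry-++ʳ X Y e

entry-interval : (s l e : ℕ) → e < l → entry (interval s l) e ≡ s + e
entry-interval s (suc l) zero    _        = sym (+-identityʳ s)
entry-interval s (suc l) (suc e) (s≤s lt) = trans (entry-interval (suc s) l e lt) (sym (+-suc s e))

entry-ι : {n d : ℕ} → d < n → entry (ι n) d ≡ d
entry-ι {n} {d} d<n = entry-interval 0 n d d<n

entry-∈ : (xs : List ℕ) {d : ℕ} → d < length xs → entry xs d ∈ xs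
entry-∈ (x ∷ xs) {zero}  _        = here refl
entry-∈ (x ∷ xs) {suc d} (s≤s lt) = there (entry-∈ xs lt)

entry-shift : (x : ℕ) (xs : List ℕ) (s l : ℕ) →
  map (entry (x ∷ xs)) (interval (suc s) l) ≡ map (entry xs) (interval s l)
entry-shift x xs s zero    = refl
entry-shift x xs s (suc l) = cong (entry xs s ∷_) (entry-shift x xs (suc s) l)

entries : (xs : List ℕ) → xs ≡ map (entry xs) (ι (length xs))
entries []       = refl
entries (x ∷ xs) = cong (x ∷_) (trans (entries xs) (sym (entry-shift x xs 0 (length xs))))

entry-injective : (xs : List ℕ) → Unique xs → {d d′ : ℕ} → d < length xs → d′ < length xs →
  entry xs d ≡ entry xs d′ → d ≡ d′
entry-injective (x ∷ xs) _          {zero}  {zero}   _        _         _  = refl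
entry-injective (x ∷ xs) (x∉ ∷ _)   {zero}  {suc d′} _        (s≤s lt′) eq = ⊥-elim (All.lookup x∉ (entry-∈ xs lt′) eq)
entry-injective (x ∷ xs) (x∉ ∷ _)   {suc d} {zero}   (s≤s lt) _         eq = ⊥-elim (All.lookup x∉ (entry-∈ xs lt) (sym eq))
entry-injective (x ∷ xs) (_ ∷ uniq) {suc d} {suc d′} (s≤s lt) (s≤s lt′) eq = cong suc (entry-injective xs uniq lt lt′ eq)

map-injective-below : (n : ℕ) (g : ℕ → ℕ) → (∀ {d d′} → d < n → d′ < n → g d ≡ g d′ → d ≡ d′) →
  {u v : List ℕ} → All (_< n) u → All (_< n) v → map g u ≡ map g v → u ≡ v
map-injective-below n g g-inj {[]}    {[]}    _          _          _  = refl
map-injective-below n g g-inj {x ∷ u} {y ∷ v} (x< ∷ u<) (y< ∷ v<) eq with ∷-injective eq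
... | gx≡gy , gu≡gv = cong₂ _∷_ (g-inj x< y< gx≡gy) (map-injective-below n g g-inj u< v< gu≡gv)

Unique-map-on : {f : A → B} {P : A → Set} {xs : List A} → All P xs →
  (∀ {x y} → P x → P y → f x ≡ f y → x ≡ y) → Unique xs → Unique (map f xs)
Unique-map-on                     {xs = []}     _          _     _          = []
Unique-map-on {A = A} {f = f} {P} {xs = x ∷ xs} (px ∷ pxs) f-inj (x∉ ∷ uniq) = fresh pxs x∉ ∷ Unique-map-on pxs f-inj uniq
  where
  fresh : {ys : List A} → All P ys → All (x ≢_) ys → All (f x ≢_) (map f ys)
  fresh []         []          = []
  fresh (py ∷ pys) (x≢y ∷ x∉′) = (λ fx≡fy → x≢y (f-inj px py fx≡fy)) ∷ fresh pys x∉′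

entry-outside-middle : (X T W S : List ℕ) → length T ≡ length W → {d : ℕ} →
  d < length X ⊎ length X + length W ≤ d → entry (X ++ T ++ S) d ≡ entry (X ++ W ++ S) d
entry-outside-middle X T W S |T| (inj₁ d<X) = trans (entry-++ˡ X _ d<X) (sym (entry-++ˡ X _ d<X))
entry-outside-middle X T W S |T| {d} (inj₂ X+W≤d) = begin
  entry (X ++ T ++ S) d                                ≡⟨ cong (entry (X ++ T ++ S)) (position T |T|) ⟩
  entry (X ++ T ++ S) (length X + (length T + e))      ≡⟨ entry-++ʳ X _ _ ⟩
  entry (T ++ S) (length T + e)                        ≡⟨ entry-++ʳ T S e ⟩
  entry S e                                            ≡⟨ entry-++ʳ W S e ⟨
  entry (W ++ S) (length W + e)                        ≡⟨ entry-++ʳ X _ _ ⟨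
  entry (X ++ W ++ S) (length X + (length W + e))      ≡⟨ cong (entry (X ++ W ++ S)) (position W refl) ⟨
  entry (X ++ W ++ S) d                                ∎
  where
  open ≡-Reasoning
  e : ℕ
  e = d ∸ (length X + length W)
  position : (U : List ℕ) → length U ≡ length W → d ≡ length X + (length U + e)
  position U |U| = begin
    d                                    ≡⟨ m+[n∸m]≡n X+W≤d ⟨
    length X + length W + e              ≡⟨ +-assoc (length X) (length W) e ⟩
    length X + (length W + e)            ≡⟨ cong (λ l → length X + (l + e)) |U| ⟨
    length X + (length U + e)            ∎

boundedTdrl-fixes-outside : (k i : ℕ) (b : List Bool) (xs : List ℕ) → i + k ≤ length xs → length b ≡ k →
  {d : ℕ} → d < i ⊎ i + k ≤ d → entry (boundedTdrl k i b xs) d ≡ entry xs d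
boundedTdrl-fixes-outside k i b xs fits |b| {d} outside with window-split i k xs fits
... | X , W , S , refl , refl , refl =
  trans (cong (λ w → entry w d) (boundedTdrl-window X W S b))
        (entry-outside-middle X (tdrl W b) W S (Perm.↭-length (tdrl-↭ W b (≤-reflexive (sym |b|)))) outside)

Step : ℕ → ℕ → List ℕ → List ℕ → Set
Step n k π ρ = ∃[ i ] ∃[ b ] ((i + k ≤ n) × (length b ≡ k) × (ρ ≡ boundedTdrl k i b π))

Step-↭ : {n k : ℕ} {xs ys : List ℕ} → Step n k xs ys → ys ↭ xs
Step-↭ {n} {k} {xs} (i , b , _ , |b| , refl) = boundedTdrl-↭ k i b xs |b|

Step-All : {n k : ℕ} {P : ℕ → Set} {xs ys : List ℕ} → Step n k xs ys → All P xs → All P ys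
Step-All step = Perm.All-resp-↭ (↭-sym (Step-↭ step))

identity-step : (n k : ℕ) → k ≤ n → Step n k (ι n) (ι n)
identity-step n k k≤n =
  0 , replicate k true , k≤n , length-replicate k ,
  sym (boundedTdrl-all-true k (ι n) (subst (k ≤_) (sym (length-interval 0 n)) k≤n))

blockSwap : ℕ → ℕ → ℕ → ℕ → List ℕ
blockSwap p a c q = interval 0 p ++ interval (p + a) c ++ interval p a ++ interval (p + a + c) q

ι-blocks : (p a c q : ℕ) →
  ι (p + a + c + q) ≡ interval 0 p ++ interval p a ++ interval (p + a) c ++ interval (p + a + c) q
ι-blocks p a c q = begin
  interval 0 (p + a + c + q)                         ≡⟨ cong (interval 0) (trans (+-assoc (p + a) c q) (+-assoc p a (c + q))) ⟩
  interval 0 (p + (a + (c + q)))                     ≡⟨ interval-++ 0 p (a + (c + q)) ⟩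
  interval 0 p ++ interval p (a + (c + q))           ≡⟨ cong (interval 0 p ++_) (interval-++ p a (c + q)) ⟩
  interval 0 p ++ interval p a ++ interval (p + a) (c + q)
    ≡⟨ cong (λ t → interval 0 p ++ interval p a ++ t) (interval-++ (p + a) c q) ⟩
  interval 0 p ++ interval p a ++ interval (p + a) c ++ interval (p + a + c) q ∎
  where open ≡-Reasoning

blockSwap-emptyˡ : (p c q : ℕ) → blockSwap p 0 c q ≡ ι (p + 0 + c + q)
blockSwap-emptyˡ p c q = sym (ι-blocks p 0 c q)

blockSwap-emptyʳ : (p a q : ℕ) → blockSwap p a 0 q ≡ ι (p + a + 0 + q)
blockSwap-emptyʳ p a q = sym (ι-blocks p a 0 q)

module _ (p a c q : ℕ) where

  private
    P A′ B′ Q : List ℕ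
    P = interval 0 p
    A′ = interval p a
    B′ = interval (p + a) c
    Q = interval (p + a + c) q

  blockSwap-prefix : {d : ℕ} → d < p → entry (blockSwap p a c q) d ≡ d
  blockSwap-prefix {d} d<p = trans (entry-++ˡ P _ (subst (d <_) (sym (length-interval 0 p)) d<p))
                                   (entry-interval 0 p d d<p)

  blockSwap-moved-forward : {e : ℕ} → e < c → entry (blockSwap p a c q) (p + e) ≡ p + a + e
  blockSwap-moved-forward {e} e<c = begin
    entry (blockSwap p a c q) (p + e)              ≡⟨ cong (λ t → entry (blockSwap p a c q) (t + e)) (length-interval 0 p) ⟨
    entry (P ++ B′ ++ A′ ++ Q) (length P + e)      ≡⟨ entry-++ʳ P _ e ⟩
    entry (B′ ++ A′ ++ Q) e                        ≡⟨ entry-++ˡ B′ _ (subst (e <_) (sym (length-interval (p + a) c)) e<c) ⟩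
    entry B′ e                                     ≡⟨ entry-interval (p + a) c e e<c ⟩
    p + a + e                                      ∎
    where open ≡-Reasoning

  blockSwap-moved-back : {e : ℕ} → e < a → entry (blockSwap p a c q) (p + c + e) ≡ p + e
  blockSwap-moved-back {e} e<a = begin
    entry (blockSwap p a c q) (p + c + e)                       ≡⟨ cong (entry (blockSwap p a c q)) position ⟩
    entry (P ++ B′ ++ A′ ++ Q) (length P + (length B′ + e))     ≡⟨ entry-++ʳ P _ _ ⟩
    entry (B′ ++ A′ ++ Q) (length B′ + e)                       ≡⟨ entry-++ʳ B′ _ e ⟩
    entry (A′ ++ Q) e                                           ≡⟨ entry-++ˡ A′ Q (subst (e <_) (sym (length-interval p a)) e<a) ⟩
    entry A′ e                                                  ≡⟨ entry-interval p a e e<a ⟩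
    p + e                                                       ∎
    where
    open ≡-Reasoning
    position : p + c + e ≡ length P + (length B′ + e)
    position = trans (+-assoc p c e) (sym (cong₂ (λ u v → u + (v + e)) (length-interval 0 p) (length-interval (p + a) c)))

shift-≢ : (m : ℕ) {a : ℕ} → 1 ≤ a → m + a ≢ m
shift-≢ m {suc a} _ = m+1+n≢m m

blockSwap-at-start : (p a c q : ℕ) → 1 ≤ c → entry (blockSwap p a c q) p ≡ p + a
blockSwap-at-start p a c q 1≤c = begin
  entry (blockSwap p a c q) p        ≡⟨ cong (entry (blockSwap p a c q)) (+-identityʳ p) ⟨
  entry (blockSwap p a c q) (p + 0)  ≡⟨ blockSwap-moved-forward p a c q 1≤c ⟩
  p + a + 0                          ≡⟨ +-identityʳ (p + a) ⟩
  p + a                              ∎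
  where open ≡-Reasoning

-- A proper block swap (a, c ≥ 1) is not the identity: position p holds p + a.
blockSwap≢ι : (n p a c q : ℕ) → 1 ≤ a → 1 ≤ c → p + a + c ≤ n → blockSwap p a c q ≢ ι n
blockSwap≢ι n p a c q 1≤a 1≤c fits eq = shift-≢ p 1≤a (begin
  p + a                        ≡⟨ blockSwap-at-start p a c q 1≤c ⟨
  entry (blockSwap p a c q) p  ≡⟨ cong (λ w → entry w p) eq ⟩
  entry (ι n) p                ≡⟨ entry-ι p<n ⟩
  p                            ∎)
  where
  open ≡-Reasoning
  p<n : p < n
  p<n = <-≤-trans (m<m+n p 1≤a) (≤-trans (m≤m+n (p + a) c) fits)

-- Comparing two block swaps entry by entry recovers the start and the block lengths.
module _ (p a c q p′ a′ c′ q′ : ℕ) (1≤a : 1 ≤ a)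
         (same : blockSwap p a c q ≡ blockSwap p′ a′ c′ q′) where

  blockSwap-start-≤ : 1 ≤ c → p′ ≤ p
  blockSwap-start-≤ 1≤c with p <? p′
  ... | no  p≮p′ = ≮⇒≥ p≮p′
  ... | yes p<p′ = ⊥-elim (shift-≢ p 1≤a (begin
    p + a                          ≡⟨ blockSwap-at-start p a c q 1≤c ⟨
    entry (blockSwap p a c q) p    ≡⟨ cong (λ w → entry w p) same ⟩
    entry (blockSwap p′ a′ c′ q′) p ≡⟨ blockSwap-prefix p′ a′ c′ q′ p<p′ ⟩
    p                              ∎))
    where open ≡-Reasoning

  blockSwap-second-≤ : p ≡ p′ → a ≡ a′ → c′ ≤ c
  blockSwap-second-≤ refl refl with c <? c′
  ... | no  c≮c′ = ≮⇒≥ c≮c′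
  ... | yes c<c′ = ⊥-elim (shift-≢ p (≤-trans 1≤a (m≤m+n a c)) (begin
    p + (a + c)                              ≡⟨ +-assoc p a c ⟨
    p + a + c                                ≡⟨ blockSwap-moved-forward p a c′ q′ c<c′ ⟨
    entry (blockSwap p a c′ q′) (p + c)      ≡⟨ cong (λ w → entry w (p + c)) same ⟨
    entry (blockSwap p a c q) (p + c)        ≡⟨ cong (entry (blockSwap p a c q)) (+-identityʳ (p + c)) ⟨
    entry (blockSwap p a c q) (p + c + 0)    ≡⟨ blockSwap-moved-back p a c q 1≤a ⟩
    p + 0                                    ≡⟨ +-identityʳ p ⟩
    p                                        ∎))
    where open ≡-Reasoning

blockSwap-injective : (p a c q p′ a′ c′ q′ : ℕ) → 1 ≤ a → 1 ≤ c → 1 ≤ a′ → 1 ≤ c′ →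
  blockSwap p a c q ≡ blockSwap p′ a′ c′ q′ → (p ≡ p′) × (a ≡ a′) × (c ≡ c′)
blockSwap-injective p a c q p′ a′ c′ q′ 1≤a 1≤c 1≤a′ 1≤c′ same = p≡p′ , a≡a′ , c≡c′
  where
  p≡p′ : p ≡ p′
  p≡p′ = ≤-antisym (blockSwap-start-≤ p′ a′ c′ q′ p a c q 1≤a′ (sym same) 1≤c′)
                   (blockSwap-start-≤ p a c q p′ a′ c′ q′ 1≤a same 1≤c)
  a≡a′ : a ≡ a′
  a≡a′ = +-cancelˡ-≡ p a a′ (begin
    p + a                           ≡⟨ blockSwap-at-start p a c q 1≤c ⟨
    entry (blockSwap p a c q) p     ≡⟨ cong (λ w → entry w p) same ⟩
    entry (blockSwap p′ a′ c′ q′) p ≡⟨ cong (entry (blockSwap p′ a′ c′ q′)) p≡p′ ⟩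
    entry (blockSwap p′ a′ c′ q′) p′ ≡⟨ blockSwap-at-start p′ a′ c′ q′ 1≤c′ ⟩
    p′ + a′                         ≡⟨ cong (_+ a′) p≡p′ ⟨
    p + a′                          ∎)
    where open ≡-Reasoning
  c≡c′ : c ≡ c′
  c≡c′ = ≤-antisym (blockSwap-second-≤ p′ a′ c′ q′ p a c q 1≤a′ (sym same) (sym p≡p′) (sym a≡a′))
                   (blockSwap-second-≤ p a c q p′ a′ c′ q′ 1≤a same p≡p′ a≡a′)

IsBlockSwap : ℕ → List ℕ → Set
IsBlockSwap n w = ∃[ p ] ∃[ a ] ∃[ c ] ∃[ q ] ((p + a + c + q ≡ n) × (w ≡ blockSwap p a c q))

interleaved-intervals : (n : ℕ) (o₁ o₂ z₁ z₂ : List ℕ) → (o₁ ++ o₂) ++ (z₁ ++ z₂) ≡ ι n →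
  IsBlockSwap n ((o₁ ++ z₁) ++ (o₂ ++ z₂))
interleaved-intervals n o₁ o₂ z₁ z₂ eq with interval-split 0 n (o₁ ++ o₂) (z₁ ++ z₂) (sym eq)
... | M , R , refl , ones≡ , zeros≡
  with interval-split 0 M o₁ o₂ (sym ones≡) | interval-split M R z₁ z₂ (sym zeros≡)
... | x , y , refl , refl , refl | z , w , refl , refl , refl =
  x , y , z , w , +-assoc (x + y) z w , ++-assoc (interval 0 x) (interval (x + y) z) _

nothing-between : {y t : ℕ} (L : List ℕ) → All (y <_) L → All (_< t) L → t ≤ y → L ≡ []
nothing-between []      _          _          _   = refl
nothing-between (x ∷ L) (y<x ∷ _) (x<t ∷ _) t≤y = ⊥-elim (<-asym y<x (<-≤-trans x<t t≤y))

tdrl-sorted : (t : ℕ) (xs : List ℕ) (cs : List Bool) → AllPairs _<_ xs → length xs ≤ length cs →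
  All (_< t) (ones xs cs) → All (t ≤_) (zeros xs cs) → xs ≡ tdrl xs cs
tdrl-sorted t []       cs           _           _        _             _             = refl
tdrl-sorted t (y ∷ ys) (true ∷ cs)  (_ ∷ ys↑)   (s≤s le) (_ ∷ below)   above         =
  cong (y ∷_) (tdrl-sorted t ys cs ys↑ le below above)
tdrl-sorted t (y ∷ ys) (false ∷ cs) (y< ∷ ys↑)  (s≤s le) below         (t≤y ∷ above) = begin
  y ∷ ys                          ≡⟨ cong (y ∷_) (tdrl-sorted t ys cs ys↑ le below above) ⟩
  y ∷ ones ys cs ++ zeros ys cs   ≡⟨ cong (λ L → y ∷ L ++ zeros ys cs) none-selected ⟩
  y ∷ zeros ys cs                 ≡⟨ cong (λ L → L ++ y ∷ zeros ys cs) none-selected ⟨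
  ones ys cs ++ y ∷ zeros ys cs   ∎
  where
  open ≡-Reasoning
  none-selected : ones ys cs ≡ []
  none-selected = nothing-between (ones ys cs) (ones-All ys cs y<) below t≤y

-- Each run is its selected part followed by its unselected
-- part (tdrl-sorted, with threshold the number of selected entries), and the four parts
-- fit together as in interleaved-intervals.
two-runs-aligned : (n : ℕ) (O Z : List ℕ) (c₁ c₂ : List Bool) → AllPairs _<_ O → AllPairs _<_ Z →
  length c₁ ≡ length O → length Z ≤ length c₂ → tdrl (O ++ Z) (c₁ ++ c₂) ≡ ι n → IsBlockSwap n (O ++ Z)
two-runs-aligned n O Z c₁ c₂ O↑ Z↑ c₁-fits c₂-fits sorted =
  subst (IsBlockSwap n) (sym (cong₂ _++_ O-split Z-split)) (interleaved-intervals n o₁ o₂ z₁ z₂ whole)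
  where
  o₁ o₂ z₁ z₂ : List ℕ
  o₁ = ones O c₁
  o₂ = ones Z c₂
  z₁ = zeros O c₁
  z₂ = zeros Z c₂
  whole : (o₁ ++ o₂) ++ (z₁ ++ z₂) ≡ ι n
  whole = trans (sym (tdrl-++-aligned O Z c₁ c₂ c₁-fits)) sorted
  t : ℕ
  t = length (o₁ ++ o₂)
  bounds : All (_< t) (o₁ ++ o₂) × All (t ≤_) (z₁ ++ z₂)
  bounds = interval-parts-bounds 0 n (o₁ ++ o₂) (z₁ ++ z₂) (sym whole)
  O-split : O ≡ o₁ ++ z₁
  O-split = tdrl-sorted t O c₁ O↑ (≤-reflexive (sym c₁-fits))
              (All.++⁻ˡ o₁ (proj₁ bounds)) (All.++⁻ˡ z₁ (proj₂ bounds))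
  Z-split : Z ≡ o₂ ++ z₂
  Z-split = tdrl-sorted t Z c₂ Z↑ c₂-fits (All.++⁻ʳ o₁ (proj₁ bounds)) (All.++⁻ʳ z₁ (proj₂ bounds))

two-runs : (n : ℕ) (O Z : List ℕ) (cs : List Bool) → AllPairs _<_ O → AllPairs _<_ Z →
  length (O ++ Z) ≤ length cs → tdrl (O ++ Z) cs ≡ ι n → IsBlockSwap n (O ++ Z)
two-runs n O Z cs O↑ Z↑ fits sorted
  with split-at (length O) cs (≤-trans (m≤m+n (length O) (length Z)) (subst (_≤ length cs) (length-++ O) fits))
... | c₁ , c₂ , refl , c₁-fits = two-runs-aligned n O Z c₁ c₂ O↑ Z↑ c₁-fits c₂-fits sorted
  where
  c₂-fits : length Z ≤ length c₂
  c₂-fits = +-cancelˡ-≤ (length O) (length Z) (length c₂)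
    (subst₂ _≤_ (length-++ O) (trans (length-++ c₁) (cong (_+ length c₂) c₁-fits)) fits)

-- Anything reached from ι n by one bounded TDRL is the concatenation of two increasing runs
-- (the selected and unselected entries of ι n); if a second one leads back to ι n, it is a
-- block swap.
round-trip-is-block-swap : (n k : ℕ) (w : List ℕ) → Step n k (ι n) w → Step n k w (ι n) → IsBlockSwap n w
round-trip-is-block-swap n k w (i , b , fits , |b| , refl) (i′ , b′ , fits′ , |b′| , back)
  with boundedTdrl-is-tdrl k i b (ι n) (subst (i + k ≤_) (sym (length-interval 0 n)) fits) |b|
     | boundedTdrl-is-tdrl k i′ b′ (boundedTdrl k i b (ι n))
         (subst (i′ + k ≤_) (sym (trans (length-boundedTdrl k i b (ι n) |b|) (length-interval 0 n))) fits′) |b′|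
... | cs , _ , w≡ | cs′ , |cs′| , back≡ =
  subst (IsBlockSwap n) (sym w≡)
    (two-runs n (ones (ι n) cs) (zeros (ι n) cs) cs′
      (ones-AllPairs (ι n) cs (interval-increasing 0 n)) (zeros-AllPairs (ι n) cs (interval-increasing 0 n))
      (≤-reflexive (trans (cong length (sym w≡)) (sym |cs′|)))
      (trans (cong (λ v → tdrl v cs′) (sym w≡)) (trans (sym back≡) (sym back))))

-- A proper block swap (blocks of lengths a + 1 and c + 1) produced from ι n by a bounded
-- TDRL lies inside the window: it moves the positions p and p + (c + 1) + a, while the
-- window fixes everything outside.
module _ {n k i p a c q : ℕ} {b : List Bool} (fits : i + k ≤ n) (|b| : length b ≡ k)
         (size : p + suc a + suc c + q ≡ n)
         (swap : boundedTdrl k i b (ι n) ≡ blockSwap p (suc a) (suc c) q) where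

  private
    S : List ℕ
    S = blockSwap p (suc a) (suc c) q
    fixed : {d : ℕ} → d < n → d < i ⊎ i + k ≤ d → entry S d ≡ d
    fixed {d} d<n outside = begin
      entry S d                             ≡⟨ cong (λ w → entry w d) swap ⟨
      entry (boundedTdrl k i b (ι n)) d     ≡⟨ boundedTdrl-fixes-outside k i b (ι n) (subst (i + k ≤_) (sym (length-interval 0 n)) fits) |b| outside ⟩
      entry (ι n) d                         ≡⟨ entry-ι d<n ⟩
      d                                     ∎
      where open ≡-Reasoning
    swap-fits : p + suc a + suc c ≤ n
    swap-fits = subst (p + suc a + suc c ≤_) size (m≤m+n _ q)

  swap-starts-in-window : i ≤ p
  swap-starts-in-window with p <? i
  ... | no  p≮i = ≮⇒≥ p≮i
  ... | yes p<i = ⊥-elim (shift-≢ p (s≤s z≤n) (trans (sym (blockSwap-at-start p (suc a) (suc c) q (s≤s z≤n)))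
                   (fixed (<-≤-trans (m<m+n p (s≤s z≤n)) (≤-trans (m≤m+n (p + suc a) (suc c)) swap-fits)) (inj₁ p<i))))

  swap-ends-in-window : p + suc a + suc c ≤ i + k
  swap-ends-in-window with p + suc a + suc c ≤? i + k
  ... | yes ends-inside  = ends-inside
  ... | no  ends-outside = ⊥-elim (shift-≢ (p + a) (s≤s z≤n) (begin
    p + a + suc c                    ≡⟨ last-moved p a c ⟨
    d                                ≡⟨ fixed d<n (inj₂ (≤-pred (subst (i + k <_) (last-position p a c) (≰⇒> ends-outside)))) ⟨
    entry S d                        ≡⟨ blockSwap-moved-back p (suc a) (suc c) q ≤-refl ⟩
    p + a                            ∎))
    where
    open ≡-Reasoning
    d : ℕ
    d = p + suc c + a
    last-moved : (p a c : ℕ) → p + suc c + a ≡ p + a + suc c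
    last-moved = solve-∀
    last-position : (p a c : ℕ) → p + suc a + suc c ≡ suc (p + suc c + a)
    last-position = solve-∀
    d<n : d < n
    d<n = subst (_≤ n) (last-position p a c) swap-fits

window-width : {i p a c k : ℕ} → i ≤ p → p + a + c ≤ i + k → a + c ≤ k
window-width {i} {p} {a} {c} {k} i≤p ends = +-cancelˡ-≤ i (a + c) k (begin
  i + (a + c)   ≤⟨ +-monoˡ-≤ (a + c) i≤p ⟩
  p + (a + c)   ≡⟨ +-assoc p a c ⟨
  p + a + c     ≤⟨ ends ⟩
  i + k         ∎)
  where open ≤-Reasoning

Triple : Set
Triple = ℕ × ℕ × ℕ

Admissible : ℕ → ℕ → Triple → Set
Admissible n k (p , a , c) = (1 ≤ a) × (1 ≤ c) × (a + c ≤ k) × (p + a + c ≤ n)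

swapOf : ℕ → Triple → List ℕ
swapOf n (p , a , c) = blockSwap p a c (n ∸ (p + a + c))

round-trip-from-ι : (n k : ℕ) (w : List ℕ) → Step n k (ι n) w → Step n k w (ι n) →
  w ≡ ι n ⊎ ∃[ t ] (Admissible n k t × (w ≡ swapOf n t))
round-trip-from-ι n k w step@(i , b , fits , |b| , w≡) step′ with round-trip-is-block-swap n k w step step′
... | p , zero  , c     , q , size , refl = inj₁ (trans (blockSwap-emptyˡ p c q) (cong ι size))
... | p , suc a , zero  , q , size , refl = inj₁ (trans (blockSwap-emptyʳ p (suc a) q) (cong ι size))
... | p , suc a , suc c , q , size , refl =
  inj₂ ((p , suc a , suc c) , (s≤s z≤n , s≤s z≤n , width , swap-fits) , cong (blockSwap p (suc a) (suc c)) q≡)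
  where
  width : suc a + suc c ≤ k
  width = window-width (swap-starts-in-window fits |b| size (sym w≡)) (swap-ends-in-window fits |b| size (sym w≡))
  swap-fits : p + suc a + suc c ≤ n
  swap-fits = subst (p + suc a + suc c ≤_) size (m≤m+n _ q)
  q≡ : q ≡ n ∸ (p + suc a + suc c)
  q≡ = sym (trans (cong (_∸ (p + suc a + suc c)) (sym size)) (m+n∸m≡n (p + suc a + suc c) q))

-- The pattern 1…1 0…0 1…1 0…0 exchanges the two middle blocks of a window.
exchangePattern : ℕ → ℕ → ℕ → ℕ → List Bool
exchangePattern u a c v = replicate u true ++ (replicate a false ++ replicate c true) ++ replicate v false

length-exchangePattern : (u a c v : ℕ) → length (exchangePattern u a c v) ≡ u + (a + c + v)
length-exchangePattern u a c v
  rewrite length-++ (replicate u true) {(replicate a false ++ replicate c true) ++ replicate v false}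
        | length-++ (replicate a false ++ replicate c true) {replicate v false}
        | length-++ (replicate a false) {replicate c true}
        | length-replicate u {true} | length-replicate a {false}
        | length-replicate c {true} | length-replicate v {false} = refl

boundedTdrl-exchange : (X U M N V R : List ℕ) {i u m m′ v : ℕ} →
  length X ≡ i → length U ≡ u → length M ≡ m → length N ≡ m′ → length V ≡ v →
  boundedTdrl (u + (m + m′ + v)) i (exchangePattern u m m′ v) (X ++ (U ++ (M ++ N) ++ V) ++ R)
    ≡ X ++ (U ++ (N ++ M) ++ V) ++ R
boundedTdrl-exchange X U M N V R refl refl refl refl refl = begin
  boundedTdrl (length U + (length M + length N + length V)) (length X) bits (X ++ W ++ R)
    ≡⟨ cong (λ k → boundedTdrl k (length X) bits (X ++ W ++ R)) |W| ⟨
  boundedTdrl (length W) (length X) bits (X ++ W ++ R)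
    ≡⟨ boundedTdrl-window X W R bits ⟩
  X ++ tdrl W bits ++ R
    ≡⟨ cong (λ T → X ++ T ++ R) (tdrl-inside U (M ++ N) V _ |middle|) ⟩
  X ++ (U ++ tdrl (M ++ N) (replicate (length M) false ++ replicate (length N) true) ++ V) ++ R
    ≡⟨ cong (λ T → X ++ (U ++ T ++ V) ++ R) (tdrl-exchange M N) ⟩
  X ++ (U ++ (N ++ M) ++ V) ++ R ∎
  where
  open ≡-Reasoning
  W : List ℕ
  W = U ++ (M ++ N) ++ V
  bits : List Bool
  bits = exchangePattern (length U) (length M) (length N) (length V)
  |W| : length W ≡ length U + (length M + length N + length V)
  |W| rewrite length-++ U {(M ++ N) ++ V} | length-++ (M ++ N) {V} | length-++ M {N} = refl
  |middle| : length (replicate (length M) false ++ replicate (length N) true) ≡ length (M ++ N)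
  |middle| rewrite length-++ (replicate (length M) false) {replicate (length N) true}
                 | length-replicate (length M) {false} | length-replicate (length N) {true}
                 | length-++ M {N} = refl

frame : (X U M V R : List ℕ) → (X ++ U) ++ M ++ (V ++ R) ≡ X ++ (U ++ M ++ V) ++ R
frame (x ∷ X) U       M V R = cong (x ∷_) (frame X U M V R)
frame []      (u ∷ U) M V R = cong (u ∷_) (frame [] U M V R)
frame []      []      M V R = sym (++-assoc M V R)

module _ (i u a c v r : ℕ) where

  private
    p q : ℕ
    p = i + u
    q = v + r
    X U A′ B′ V R : List ℕ
    X = interval 0 i
    U = interval i u
    A′ = interval p a
    B′ = interval (p + a) c
    V = interval (p + a + c) v
    R = interval (p + a + c + v) r

    around : (M N : List ℕ) → interval 0 p ++ M ++ N ++ interval (p + a + c) q ≡ X ++ (U ++ (M ++ N) ++ V) ++ R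
    around M N = begin
      interval 0 p ++ M ++ N ++ interval (p + a + c) q  ≡⟨ cong (interval 0 p ++_) (++-assoc M N _) ⟨
      interval 0 p ++ (M ++ N) ++ interval (p + a + c) q
        ≡⟨ cong₂ (λ P Q → P ++ (M ++ N) ++ Q) (interval-++ 0 i u) (interval-++ (p + a + c) v r) ⟩
      (X ++ U) ++ (M ++ N) ++ (V ++ R)                   ≡⟨ frame X U (M ++ N) V R ⟩
      X ++ (U ++ (M ++ N) ++ V) ++ R                     ∎
      where open ≡-Reasoning

    ι-form : ι (p + a + c + q) ≡ X ++ (U ++ (A′ ++ B′) ++ V) ++ R
    ι-form = trans (ι-blocks p a c q) (around A′ B′)

    swap-form : blockSwap p a c q ≡ X ++ (U ++ (B′ ++ A′) ++ V) ++ R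
    swap-form = around B′ A′

    exchange : (M N : List ℕ) {m m′ : ℕ} → length M ≡ m → length N ≡ m′ →
      boundedTdrl (u + (m + m′ + v)) i (exchangePattern u m m′ v) (X ++ (U ++ (M ++ N) ++ V) ++ R)
        ≡ X ++ (U ++ (N ++ M) ++ V) ++ R
    exchange M N |M| |N| = boundedTdrl-exchange X U M N V R (length-interval 0 i) (length-interval i u)
                             |M| |N| (length-interval (p + a + c) v)

  exchange-forth : boundedTdrl (u + (a + c + v)) i (exchangePattern u a c v) (ι (p + a + c + q)) ≡ blockSwap p a c q
  exchange-forth = begin
    boundedTdrl (u + (a + c + v)) i (exchangePattern u a c v) (ι (p + a + c + q))
      ≡⟨ cong (boundedTdrl (u + (a + c + v)) i (exchangePattern u a c v)) ι-form ⟩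
    boundedTdrl (u + (a + c + v)) i (exchangePattern u a c v) (X ++ (U ++ (A′ ++ B′) ++ V) ++ R)
      ≡⟨ exchange A′ B′ (length-interval p a) (length-interval (p + a) c) ⟩
    X ++ (U ++ (B′ ++ A′) ++ V) ++ R
      ≡⟨ swap-form ⟨
    blockSwap p a c q ∎
    where open ≡-Reasoning

  exchange-back : boundedTdrl (u + (a + c + v)) i (exchangePattern u c a v) (blockSwap p a c q) ≡ ι (p + a + c + q)
  exchange-back = begin
    boundedTdrl (u + (a + c + v)) i (exchangePattern u c a v) (blockSwap p a c q)
      ≡⟨ cong₂ (λ k w → boundedTdrl k i (exchangePattern u c a v) w) (cong (λ s → u + (s + v)) (+-comm a c)) swap-form ⟩
    boundedTdrl (u + (c + a + v)) i (exchangePattern u c a v) (X ++ (U ++ (B′ ++ A′) ++ V) ++ R)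
      ≡⟨ exchange B′ A′ (length-interval (p + a) c) (length-interval p a) ⟩
    X ++ (U ++ (A′ ++ B′) ++ V) ++ R
      ≡⟨ ι-form ⟨
    ι (p + a + c + q) ∎
    where open ≡-Reasoning

window-start : (n k p s : ℕ) → k ≤ n → s ≤ k → p + s ≤ n → ∃[ i ] ((i ≤ p) × (p + s ≤ i + k) × (i + k ≤ n))
window-start n k p s k≤n s≤k fits with p + k ≤? n
... | yes p+k≤n = p , ≤-refl , +-monoʳ-≤ p s≤k , p+k≤n
... | no  p+k≰n = n ∸ k , start≤p , subst (p + s ≤_) (sym (m∸n+n≡m k≤n)) fits , ≤-reflexive (m∸n+n≡m k≤n)
  where
  start≤p : n ∸ k ≤ p
  start≤p = ≤-trans (∸-monoˡ-≤ k (<⇒≤ (≰⇒> p+k≰n))) (≤-reflexive (m+n∸n≡m p k))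

-- The same window, described by the sizes u, v of the parts of the window before and
-- after the exchanged blocks and the size r of the part after the window.
window-around : (n k p s : ℕ) → k ≤ n → s ≤ k → p + s ≤ n →
  ∃[ i ] ∃[ u ] ∃[ v ] ∃[ r ] ((p ≡ i + u) × (u + (s + v) ≡ k) × (p + s + (v + r) ≡ n))
window-around n k p s k≤n s≤k fits with window-start n k p s k≤n s≤k fits
... | i , i≤p , ends , i+k≤n with m≤n⇒∃[o]m+o≡n i≤p | m≤n⇒∃[o]m+o≡n ends | m≤n⇒∃[o]m+o≡n i+k≤n
... | u , refl | v , ends≡ | r , refl = i , u , v , r , refl , width , total
  where
  regroup : (i u s v : ℕ) → i + (u + (s + v)) ≡ i + u + s + v
  regroup = solve-∀
  width : u + (s + v) ≡ k
  width = +-cancelˡ-≡ i (u + (s + v)) k (trans (regroup i u s v) ends≡)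
  total : i + u + s + (v + r) ≡ i + k + r
  total = trans (sym (+-assoc (i + u + s) v r)) (cong (_+ r) ends≡)

swap-reachable : (n k : ℕ) (t : Triple) → k ≤ n → Admissible n k t →
  Step n k (ι n) (swapOf n t) × Step n k (swapOf n t) (ι n)
swap-reachable n k (p , a , c) k≤n (_ , _ , width , fits)
  with window-around n k p (a + c) k≤n width (subst (_≤ n) (+-assoc p a c) fits)
... | i , u , v , r , refl , refl , total =
  (i , exchangePattern u a c v , window-fits , length-exchangePattern u a c v , forth) ,
  (i , exchangePattern u c a v , window-fits , back-length , back)
  where
  open ≡-Reasoning
  regroup : (i u s v r : ℕ) → i + (u + (s + v)) + r ≡ i + u + s + (v + r)
  regroup = solve-∀
  size : p + a + c + (v + r) ≡ n
  size = trans (cong (_+ (v + r)) (+-assoc p a c)) total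
  window-fits : i + k ≤ n
  window-fits = subst (i + k ≤_) (trans (regroup i u (a + c) v r) total) (m≤m+n (i + k) r)
  q≡ : n ∸ (p + a + c) ≡ v + r
  q≡ = trans (cong (_∸ (p + a + c)) (sym size)) (m+n∸m≡n (p + a + c) (v + r))
  back-length : length (exchangePattern u c a v) ≡ k
  back-length = trans (length-exchangePattern u c a v) (cong (λ s → u + (s + v)) (+-comm c a))
  forth : swapOf n (p , a , c) ≡ boundedTdrl k i (exchangePattern u a c v) (ι n)
  forth = begin
    blockSwap p a c (n ∸ (p + a + c))   ≡⟨ cong (blockSwap p a c) q≡ ⟩
    blockSwap p a c (v + r)             ≡⟨ exchange-forth i u a c v r ⟨
    boundedTdrl k i (exchangePattern u a c v) (ι (p + a + c + (v + r)))
                                        ≡⟨ cong (λ m → boundedTdrl k i (exchangePattern u a c v) (ι m)) size ⟩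
    boundedTdrl k i (exchangePattern u a c v) (ι n) ∎
  back : ι n ≡ boundedTdrl k i (exchangePattern u c a v) (swapOf n (p , a , c))
  back = begin
    ι n                                 ≡⟨ cong ι size ⟨
    ι (p + a + c + (v + r))             ≡⟨ exchange-back i u a c v r ⟨
    boundedTdrl k i (exchangePattern u c a v) (blockSwap p a c (v + r))
                                        ≡⟨ cong (λ q → boundedTdrl k i (exchangePattern u c a v) (blockSwap p a c q)) q≡ ⟨
    boundedTdrl k i (exchangePattern u c a v) (swapOf n (p , a , c)) ∎

-- Enumerating admissible triples: withOffsets N a c lists the triples (p, a, c) with p < N,
-- withSpan s N j those of span s with 1 ≤ a ≤ j, and admissibleTriples n k those of span
-- at most k, adding the s · (n - s) triples of span s + 1 at each step.
withOffsets : ℕ → ℕ → ℕ → List Triple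
withOffsets N a c = map (λ p → (p , a , c)) (upTo N)

∈-withOffsets⁻ : {N a c p a′ c′ : ℕ} → (p , a′ , c′) ∈ withOffsets N a c → (p < N) × (a′ ≡ a) × (c′ ≡ c)
∈-withOffsets⁻ {N} {a} {c} t∈ with ∈-map⁻ (λ p → (p , a , c)) t∈
... | _ , p∈ , refl = ∈-upTo⁻ p∈ , refl , refl

∈-withOffsets⁺ : {N a c p : ℕ} → p < N → (p , a , c) ∈ withOffsets N a c
∈-withOffsets⁺ {N} {a} {c} p<N = ∈-map⁺ (λ p → (p , a , c)) (∈-upTo⁺ p<N)

withOffsets-unique : (N a c : ℕ) → Unique (withOffsets N a c)
withOffsets-unique N a c = Unique.map⁺ (cong proj₁) (Unique.upTo⁺ N)

length-withOffsets : (N a c : ℕ) → length (withOffsets N a c) ≡ N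
length-withOffsets N a c = trans (length-map _ (upTo N)) (length-upTo N)

withSpan : ℕ → ℕ → ℕ → List Triple
withSpan s N zero    = []
withSpan s N (suc j) = withSpan s N j ++ withOffsets N (suc j) (s ∸ suc j)

InWithSpan : ℕ → ℕ → ℕ → Triple → Set
InWithSpan s N j (p , a , c) = (1 ≤ a) × (a ≤ j) × (c ≡ s ∸ a) × (p < N)

∈-withSpan⁻ : (s N j : ℕ) (t : Triple) → t ∈ withSpan s N j → InWithSpan s N j t
∈-withSpan⁻ s N (suc j) t t∈ with ∈-++⁻ (withSpan s N j) t∈
... | inj₁ t∈′ with ∈-withSpan⁻ s N j t t∈′
...   | 1≤a , a≤j , c≡ , p<N = 1≤a , m≤n⇒m≤1+n a≤j , c≡ , p<N
∈-withSpan⁻ s N (suc j) (p , a , c) t∈ | inj₂ t∈′ with ∈-withOffsets⁻ t∈′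
...   | p<N , refl , refl = s≤s z≤n , ≤-refl , refl , p<N

∈-withSpan⁺ : (s N j : ℕ) (t : Triple) → InWithSpan s N j t → t ∈ withSpan s N j
∈-withSpan⁺ s N zero    (p , zero  , c) (() , _)
∈-withSpan⁺ s N zero    (p , suc a , c) (_ , () , _)
∈-withSpan⁺ s N (suc j) (p , a , c) (1≤a , a≤1+j , c≡ , p<N) with m≤n⇒m<n∨m≡n a≤1+j
... | inj₁ (s≤s a≤j) = ∈-++⁺ˡ (∈-withSpan⁺ s N j (p , a , c) (1≤a , a≤j , c≡ , p<N))
... | inj₂ refl rewrite c≡ = ∈-++⁺ʳ (withSpan s N j) (∈-withOffsets⁺ p<N)

withSpan-unique : (s N j : ℕ) → Unique (withSpan s N j)
withSpan-unique s N zero    = []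
withSpan-unique s N (suc j) = Unique.++⁺ (withSpan-unique s N j) (withOffsets-unique N (suc j) (s ∸ suc j)) disjoint
  where
  disjoint : {t : Triple} → ¬ (t ∈ withSpan s N j × t ∈ withOffsets N (suc j) (s ∸ suc j))
  disjoint {p , a , c} (t∈ , t∈′) with ∈-withSpan⁻ s N j _ t∈ | ∈-withOffsets⁻ t∈′
  ... | _ , a≤j , _ , _ | _ , refl , _ = <-irrefl refl a≤j

length-withSpan : (s N j : ℕ) → length (withSpan s N j) ≡ j * N
length-withSpan s N zero    = refl
length-withSpan s N (suc j) = begin
  length (withSpan s N j ++ withOffsets N (suc j) (s ∸ suc j))  ≡⟨ length-++ (withSpan s N j) ⟩
  length (withSpan s N j) + length (withOffsets N (suc j) _)    ≡⟨ cong₂ _+_ (length-withSpan s N j) (length-withOffsets N _ _) ⟩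
  j * N + N                                                     ≡⟨ +-comm (j * N) N ⟩
  suc j * N                                                     ∎
  where open ≡-Reasoning

withSpan-span : {s N : ℕ} (t : Triple) → InWithSpan (suc s) N s t → let (_ , a , c) = t in a + c ≡ suc s
withSpan-span (p , a , c) (_ , a≤s , refl , _) = m+[n∸m]≡n (m≤n⇒m≤1+n a≤s)

admissibleTriples : ℕ → ℕ → List Triple
admissibleTriples n zero    = []
admissibleTriples n (suc s) = admissibleTriples n s ++ withSpan (suc s) (n ∸ s) s

<∸⇒+< : (p n s : ℕ) → p < n ∸ s → p + s < n
<∸⇒+< p n s p<n∸s with s ≤? n
... | yes s≤n = m≤o∸n⇒m+n≤o (suc p) s≤n p<n∸s
... | no  s≰n with () ← subst (p <_) (m≤n⇒m∸n≡0 (<⇒≤ (≰⇒> s≰n))) p<n∸s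

module _ (n s : ℕ) where

  span-exactly⁻ : (t : Triple) → InWithSpan (suc s) (n ∸ s) s t → Admissible n (suc s) t
  span-exactly⁻ t@(p , a , c) in-span@(1≤a , a≤s , refl , p<n∸s) = 1≤a , 1≤c , ≤-reflexive span , fits
    where
    span : a + (suc s ∸ a) ≡ suc s
    span = withSpan-span t in-span
    1≤c : 1 ≤ suc s ∸ a
    1≤c = subst (1 ≤_) (sym (+-∸-assoc 1 a≤s)) (s≤s z≤n)
    fits : p + a + (suc s ∸ a) ≤ n
    fits = subst (_≤ n) (sym (trans (+-assoc p a _) (trans (cong (p +_) span) (+-suc p s)))) (<∸⇒+< p n s p<n∸s)

  span-exactly⁺ : (t : Triple) → Admissible n (suc s) t → let (_ , a , c) = t in a + c ≡ suc s →
    InWithSpan (suc s) (n ∸ s) s t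
  span-exactly⁺ (p , a , c) (1≤a , 1≤c , _ , fits) span = 1≤a , a≤s , c≡ , p<n∸s
    where
    a≤s : a ≤ s
    a≤s = ≤-pred (subst₂ _≤_ (+-comm a 1) span (+-monoʳ-≤ a 1≤c))
    c≡ : c ≡ suc s ∸ a
    c≡ = trans (sym (m+n∸m≡n a c)) (cong (_∸ a) span)
    p<n∸s : p < n ∸ s
    p<n∸s = m+n≤o⇒m≤o∸n (suc p) (subst (_≤ n) (trans (+-assoc p a c) (trans (cong (p +_) span) (+-suc p s))) fits)

admissible-wider : {n s : ℕ} (t : Triple) → Admissible n s t → Admissible n (suc s) t
admissible-wider (p , a , c) (1≤a , 1≤c , a+c≤s , fits) = 1≤a , 1≤c , m≤n⇒m≤1+n a+c≤s , fits

∈-admissibleTriples⁻ : (n k : ℕ) (t : Triple) → t ∈ admissibleTriples n k → Admissible n k t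
∈-admissibleTriples⁻ n (suc s) t t∈ with ∈-++⁻ (admissibleTriples n s) t∈
... | inj₁ t∈′ = admissible-wider t (∈-admissibleTriples⁻ n s t t∈′)
... | inj₂ t∈′ = span-exactly⁻ n s t (∈-withSpan⁻ (suc s) (n ∸ s) s t t∈′)

∈-admissibleTriples⁺ : (n k : ℕ) (t : Triple) → Admissible n k t → t ∈ admissibleTriples n k
∈-admissibleTriples⁺ n zero    (p , zero  , c) (() , _)
∈-admissibleTriples⁺ n zero    (p , suc a , c) (_ , _ , () , _)
∈-admissibleTriples⁺ n (suc s) (p , a , c) adm@(1≤a , 1≤c , a+c≤1+s , fits) with m≤n⇒m<n∨m≡n a+c≤1+s
... | inj₁ (s≤s a+c≤s) = ∈-++⁺ˡ (∈-admissibleTriples⁺ n s _ (1≤a , 1≤c , a+c≤s , fits))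
... | inj₂ span        = ∈-++⁺ʳ (admissibleTriples n s) (∈-withSpan⁺ _ _ _ _ (span-exactly⁺ n s _ adm span))

-- Different spans give different triples.
admissibleTriples-unique : (n k : ℕ) → Unique (admissibleTriples n k)
admissibleTriples-unique n zero    = []
admissibleTriples-unique n (suc s) =
  Unique.++⁺ (admissibleTriples-unique n s) (withSpan-unique (suc s) (n ∸ s) s) disjoint
  where
  disjoint : {t : Triple} → ¬ (t ∈ admissibleTriples n s × t ∈ withSpan (suc s) (n ∸ s) s)
  disjoint {t@(p , a , c)} (t∈ , t∈′) with ∈-admissibleTriples⁻ n s t t∈
  ... | _ , _ , a+c≤s , _ = <-irrefl refl (subst (_≤ s) (withSpan-span t (∈-withSpan⁻ _ _ _ t t∈′)) a+c≤s)

-- The count, by induction on k with Pascal's rule: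
-- (n - s + 1)·C(s,2) + C(s,3) + s·(n - s) = (n - (s + 1) + 1)·C(s+1,2) + C(s+1,3).
length-admissibleTriples : (n k : ℕ) → k ≤ n → length (admissibleTriples n k) ≡ (n ∸ k + 1) * (k C 2) + k C 3
length-admissibleTriples n zero    _      = sym (cong (_+ 0) (*-zeroʳ (n + 1)))
length-admissibleTriples n (suc s) 1+s≤n = begin
  length (admissibleTriples n s ++ withSpan (suc s) (n ∸ s) s)
    ≡⟨ length-++ (admissibleTriples n s) ⟩
  length (admissibleTriples n s) + length (withSpan (suc s) (n ∸ s) s)
    ≡⟨ cong₂ _+_ (length-admissibleTriples n s (<⇒≤ 1+s≤n)) (length-withSpan (suc s) (n ∸ s) s) ⟩
  (n ∸ s + 1) * (s C 2) + s C 3 + s * (n ∸ s)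
    ≡⟨ cong (λ m → (m + 1) * (s C 2) + s C 3 + s * m) (+-∸-assoc 1 1+s≤n) ⟩
  (suc N + 1) * (s C 2) + s C 3 + s * suc N
    ≡⟨ regroup N s (s C 2) (s C 3) ⟩
  (N + 1) * (s + s C 2) + (s C 2 + s C 3)
    ≡⟨ cong₂ (λ x y → (N + 1) * x + y) pascal₂ (nCk+nC[k+1]≡[n+1]C[k+1] s 2) ⟩
  (N + 1) * (suc s C 2) + suc s C 3 ∎
  where
  open ≡-Reasoning
  N : ℕ
  N = n ∸ suc s
  regroup : (N s C₂ C₃ : ℕ) → (suc N + 1) * C₂ + C₃ + s * suc N ≡ (N + 1) * (s + C₂) + (C₂ + C₃)
  regroup = solve-∀
  pascal₂ : s + s C 2 ≡ suc s C 2
  pascal₂ = trans (cong (_+ s C 2) (sym (nC1≡n s))) (nCk+nC[k+1]≡[n+1]C[k+1] s 1)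

exchanges : ℕ → ℕ → List (List ℕ)
exchanges n k = ι n ∷ map (swapOf n) (admissibleTriples n k)

exchanges-characterisation : (n k : ℕ) → k ≤ n → (w : List ℕ) →
  (w ∈ exchanges n k) ⇔ (Step n k (ι n) w × Step n k w (ι n))
exchanges-characterisation n k k≤n w = mk⇔ to from
  where
  to : w ∈ exchanges n k → Step n k (ι n) w × Step n k w (ι n)
  to (here refl) = identity-step n k k≤n , identity-step n k k≤n
  to (there w∈) with ∈-map⁻ (swapOf n) w∈
  ... | t , t∈ , refl = swap-reachable n k t k≤n (∈-admissibleTriples⁻ n k t t∈)
  from : Step n k (ι n) w × Step n k w (ι n) → w ∈ exchanges n k
  from (forth , back) with round-trip-from-ι n k w forth back
  ... | inj₁ refl              = here refl
  ... | inj₂ (t , adm , refl)  = there (∈-map⁺ (swapOf n) (∈-admissibleTriples⁺ n k t adm))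

-- The exchanges are pairwise different: ι n is not a proper swap and swapOf is injective
-- on admissible triples.
exchanges-unique : (n k : ℕ) → Unique (exchanges n k)
exchanges-unique n k =
  All.map⁺ (All.tabulate (λ {t} t∈ → ι-not-swap t (∈-admissibleTriples⁻ n k t t∈))) ∷
  Unique-map-on (All.tabulate (λ {t} → ∈-admissibleTriples⁻ n k t)) swapOf-injective (admissibleTriples-unique n k)
  where
  ι-not-swap : (t : Triple) → Admissible n k t → ι n ≢ swapOf n t
  ι-not-swap (p , a , c) (1≤a , 1≤c , _ , fits) eq = blockSwap≢ι n p a c _ 1≤a 1≤c fits (sym eq)
  swapOf-injective : {t t′ : Triple} → Admissible n k t → Admissible n k t′ → swapOf n t ≡ swapOf n t′ → t ≡ t′
  swapOf-injective {p , a , c} {p′ , a′ , c′} (1≤a , 1≤c , _) (1≤a′ , 1≤c′ , _) eq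
    with blockSwap-injective p a c _ p′ a′ c′ _ 1≤a 1≤c 1≤a′ 1≤c′ eq
  ... | refl , refl , refl = refl

length-exchanges : (n k : ℕ) → k ≤ n → length (exchanges n k) ≡ (n ∸ k + 1) * (k C 2) + k C 3 + 1
length-exchanges n k k≤n = begin
  suc (length (map (swapOf n) (admissibleTriples n k)))  ≡⟨ cong suc (length-map (swapOf n) (admissibleTriples n k)) ⟩
  suc (length (admissibleTriples n k))                   ≡⟨ cong suc (length-admissibleTriples n k k≤n) ⟩
  suc ((n ∸ k + 1) * (k C 2) + k C 3)                    ≡⟨ +-comm 1 _ ⟩
  (n ∸ k + 1) * (k C 2) + k C 3 + 1                      ∎
  where open ≡-Reasoning

-- Every round trip from ι n is a rearrangement of it, so its entries lie below n.
exchanges-below : (n k : ℕ) → k ≤ n → All (All (_< n)) (exchanges n k)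
exchanges-below n k k≤n = All.tabulate (λ {w} w∈ →
  Step-All (proj₁ (Equivalence.to (exchanges-characterisation n k k≤n w) w∈)) (interval-upper 0 n))

module _ (n k : ℕ) (g : ℕ → ℕ) (g-inj : ∀ {d d′} → d < n → d′ < n → g d ≡ g d′ → d ≡ d′) where

  relabel-step : {xs ys : List ℕ} → Step n k xs ys → Step n k (map g xs) (map g ys)
  relabel-step {xs} (i , b , fits , |b| , refl) = i , b , fits , |b| , sym (boundedTdrl-map g k i b xs)

  unlabel-step : {xs ys : List ℕ} → All (_< n) xs → All (_< n) ys →
    Step n k (map g xs) (map g ys) → Step n k xs ys
  unlabel-step {xs} {ys} xs< ys< (i , b , fits , |b| , eq) =
    i , b , fits , |b| ,
    map-injective-below n g g-inj ys< (Step-All (i , b , fits , |b| , refl) xs<)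
      (trans eq (boundedTdrl-map g k i b xs))

  relabel-round-trips : {xs : List ℕ} → All (_< n) xs → (ρ : List ℕ) →
    (∃[ w ] ((Step n k xs w × Step n k w xs) × (ρ ≡ map g w))) ⇔ (Step n k (map g xs) ρ × Step n k ρ (map g xs))
  relabel-round-trips {xs} xs< ρ = mk⇔ to from
    where
    to : ∃[ w ] ((Step n k xs w × Step n k w xs) × (ρ ≡ map g w)) → Step n k (map g xs) ρ × Step n k ρ (map g xs)
    to (w , (forth , back) , refl) = relabel-step forth , relabel-step back
    from : Step n k (map g xs) ρ × Step n k ρ (map g xs) → ∃[ w ] ((Step n k xs w × Step n k w xs) × (ρ ≡ map g w))
    from ((i , b , fits , |b| , refl) , back) =
      w , (forth , unlabel-step w< xs< (subst (λ v → Step n k v (map g xs)) (boundedTdrl-map g k i b xs) back)) ,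
      boundedTdrl-map g k i b xs
      where
      w : List ℕ
      w = boundedTdrl k i b xs
      forth : Step n k xs w
      forth = i , b , fits , |b| , refl
      w< : All (_< n) w
      w< = Step-All forth xs<

  relabelled-exchanges : k ≤ n → (ρ : List ℕ) →
    (ρ ∈ map (map g) (exchanges n k)) ⇔ (Step n k (map g (ι n)) ρ × Step n k ρ (map g (ι n)))
  relabelled-exchanges k≤n ρ = mk⇔ to from
    where
    relabel : (∃[ w ] ((Step n k (ι n) w × Step n k w (ι n)) × (ρ ≡ map g w)))
                ⇔ (Step n k (map g (ι n)) ρ × Step n k ρ (map g (ι n)))
    relabel = relabel-round-trips (interval-upper 0 n) ρ
    characterise : (w : List ℕ) → (w ∈ exchanges n k) ⇔ (Step n k (ι n) w × Step n k w (ι n))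
    characterise = exchanges-characterisation n k k≤n
    to : ρ ∈ map (map g) (exchanges n k) → Step n k (map g (ι n)) ρ × Step n k ρ (map g (ι n))
    to ρ∈ with ∈-map⁻ (map g) ρ∈
    ... | w , w∈ , ρ≡ = Equivalence.to relabel (w , Equivalence.to (characterise w) w∈ , ρ≡)
    from : Step n k (map g (ι n)) ρ × Step n k ρ (map g (ι n)) → ρ ∈ map (map g) (exchanges n k)
    from round-trip with Equivalence.from relabel round-trip
    ... | w , w-round-trip , refl = ∈-map⁺ (map g) (Equivalence.from (characterise w) w-round-trip)

-- The permutation side conditions are automatic, since bounded TDRLs rearrange.
in-out-iff : (n k : ℕ) (π ρ : List ℕ) → IsPerm n π →
  (InSout n k π ρ × InSin n k π ρ) ⇔ (Step n k π ρ × Step n k ρ π)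
in-out-iff n k π ρ π-perm = mk⇔ (λ ((_ , forth) , (_ , _ , back)) → forth , back)
  (λ (forth , back) → let ρ-perm = ↭-trans (Step-↭ forth) π-perm in (ρ-perm , forth) , (ρ-perm , π-perm , back))

permutation-relabelling : (n : ℕ) (π : List ℕ) → IsPerm n π →
  (π ≡ map (entry π) (ι n)) × (∀ {d d′} → d < n → d′ < n → entry π d ≡ entry π d′ → d ≡ d′)
permutation-relabelling n π π-perm =
  trans (entries π) (cong (λ m → map (entry π) (ι m)) |π|) ,
  λ d<n d′<n → entry-injective π π-unique (subst (_ <_) (sym |π|) d<n) (subst (_ <_) (sym |π|) d′<n)
  where
  |π| : length π ≡ n
  |π| = trans (Perm.↭-length π-perm) (trans (length-map suc (upTo n)) (length-upTo n))
  π-unique : Unique π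
  π-unique = PermSetoid.Unique-resp-↭ (↭⇒↭ₛ (↭-sym π-perm)) (Unique.map⁺ suc-injective (Unique.upTo⁺ n))

-- The theorem: the intersection is the relabelling
-- of the round trips from ι n by the entries of π.
theorem5 : (n k : ℕ) → 1 ≤ k → k ≤ n → (π : List ℕ) → IsPerm n π →
    ∃[ L ] (Unique L × (length L ≡ (n ∸ k + 1) * (k C 2) + k C 3 + 1) ×
    ((ρ : List ℕ) → (ρ ∈ L) ⇔ (InSout n k π ρ × InSin n k π ρ)))
theorem5 n k _ k≤n π π-perm =
  map (map g) (exchanges n k) ,
  Unique-map-on (exchanges-below n k k≤n) (map-injective-below n g g-inj) (exchanges-unique n k) ,
  trans (length-map (map g) (exchanges n k)) (length-exchanges n k k≤n) ,
  λ ρ → ⇔-sym (in-out-iff n k π ρ π-perm) ⇔-∘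
          subst (λ σ → (ρ ∈ map (map g) (exchanges n k)) ⇔ (Step n k σ ρ × Step n k ρ σ)) (sym π≡)
                (relabelled-exchanges n k g g-inj k≤n ρ)
  where
  g : ℕ → ℕ
  g = entry π
  π≡ : π ≡ map g (ι n)
  π≡ = proj₁ (permutation-relabelling n π π-perm)
  g-inj : ∀ {d d′} → d < n → d′ < n → g d ≡ g d′ → d ≡ d′
  g-inj = proj₂ (permutation-relabelling n π π-perm)
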